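{- Let $L_1$ and $L_2$ be linked lists, each sorted in non-decreasing order of keys, and equipped with hop pointers satisfying the hop-pointer invariant (described in the context). Let $p$ and $q$ be the number of distinct keys in $L_1$ and $L_2$, respectively. Then the hop-pointer merge of $L_1$ and $L_2$ (described in the context) produces the sorted merged list and runs in time $O(p+q)$; in particular it performs $O(p+q)$ key comparisons.
   Context: Each node of a singly linked list stores a key, a $next$ pointer, and an additional $hop$ pointer; by default a node's hop pointer points to the node itself. In a list sorted by key, a segment is a maximal contiguous run of nodes with equal keys. The hop-pointer invariant: for every segment, the hop pointer of the first node of the segment points to the last node of the segment. Thus from the first node $x$ of a segment, $x.hop.next$ is the first node of the next segment. Hop-pointer merge of sorted lists $a$ and $b$ (given by their head nodes): if one is empty return the other. Otherwise walk both lists segment by segment. Let $a$, $b$ be the first nodes of the current segments of the two lists and $p$ the last node appended to the output. If $a.key < b.key$: append the whole segment of $a$ (set $p.next \gets a$, $p \gets a.hop$, $a \gets a.hop.next$). If $a.key > b.key$: symmetrically append the whole segment of $b$. If $a.key = b.key$: append $a$'s segment followed by $b$'s segment, and merge them into one segment by setting $a.hop.next \gets b$, then $a.hop \gets b.hop$; set $p$ to the last node of $b$'s segment and advance both $a$ and $b$ to the first nodes of their next segments. (The first output segment is chosen in the same way by comparing the first keys, using $\le$.) When one list is exhausted, the remainder of the other is attached to $p$. The cost of merging is measured by the number of loop iterations/comparisons. -}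

module Defs where

open import Level using (0ℓ)
open import Data.Nat using (ℕ; zero; suc; _+_)
open import Data.Product using (_×_; _,_)
open import Data.List using (List; []; _∷_; _++_; length; splitAt; map; deduplicate)
open import Data.List.Relation.Unary.All using (All)
open import Data.Unit using (⊤)
open import Relation.Nullary using (¬_)
open import Relation.Binary using (StrictTotalOrder; tri<; tri≈; tri>)
import Relation.Binary.Properties.StrictTotalOrder as STOProps
import Data.List.Relation.Unary.Sorted.TotalOrder as SortedMod
open import Relation.Binary.PropositionalEquality using (_≡_)

-- A list is modelled as the sequence of its nodes in `next` order.
-- Each node stores a key and its hop pointer, the latter represented as the
-- number of `next` steps from the node to the node its hop pointer points at
-- (0 = the node itself, the default).
module HopLists (O : StrictTotalOrder 0ℓ 0ℓ 0ℓ) where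

  open StrictTotalOrder O renaming (Carrier to Key)

  record Node : Set where
    constructor node
    field
      key : Key
      hop : ℕ
  open Node public

  Sorted : List Node → Set
  Sorted L = SortedMod.Sorted (STOProps.totalOrder O) (map key L)

  NotContinuing : Key → List Node → Set
  NotContinuing k []      = ⊤
  NotContinuing k (r ∷ _) = ¬ (key r ≈ k)

  -- Hop-pointer invariant: the list decomposes into maximal segments of equal
  -- keys, and the first node x of each segment has its hop pointer pointing at
  -- the last node of the segment (i.e. |segment| - 1 steps ahead).
  data HopInv : List Node → Set where
    []  : HopInv []
    seg : (x : Node) (ys rest : List Node) →
          hop x ≡ length ys →
          All (λ y → key y ≈ key x) ys →
          NotContinuing (key x) rest →
          HopInv rest →
          HopInv (x ∷ ys ++ rest)

  distinctKeys : List Node → ℕ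
  distinctKeys L = length (deduplicate _≟_ (map key L))

  -- the segment starting at the head of a (nonempty) list: the nodes from x up
  -- to x.hop, and the rest of the list starting at x.hop.next
  segment : Node → List Node → List Node × List Node
  segment x xs = splitAt (suc (hop x)) (x ∷ xs)

  -- a.hop ← b.hop : the hop of the first node of a's segment (of length la)
  -- is redirected to the node b.hop points at, which in the output list lies
  -- la + b.hop steps ahead of a.
  redirect : ℕ → ℕ → List Node → List Node
  redirect la hb []      = []
  redirect la hb (x ∷ s) = node (key x) (la + hb) ∷ s

  -- Hop-pointer merge with a fuel argument (the number of loop iterations
  -- available).  Returns the output list together with the number of loop
  -- iterations (= key comparisons) performed.
  mergeFuel : ℕ → List Node → List Node → List Node × ℕ
  mergeFuel _ [] b = b , 0
  mergeFuel _ a [] = a , 0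
  mergeFuel zero a b = a ++ b , 0
  mergeFuel (suc f) (x ∷ xs) (y ∷ ys) with compare (key x) (key y)
  ... | tri< _ _ _ with segment x xs
  ...   | sa , ra with mergeFuel f ra (y ∷ ys)
  ...     | out , c = sa ++ out , suc c
  mergeFuel (suc f) (x ∷ xs) (y ∷ ys) | tri> _ _ _ with segment y ys
  ...   | sb , rb with mergeFuel f (x ∷ xs) rb
  ...     | out , c = sb ++ out , suc c
  mergeFuel (suc f) (x ∷ xs) (y ∷ ys) | tri≈ _ _ _ with segment x xs | segment y ys
  ...   | sa , ra | sb , rb with mergeFuel f ra rb
  ...     | out , c = (redirect (length sa) (hop y) sa ++ sb) ++ out , suc c

  -- Every loop iteration consumes at least one node, so
  -- |a| + |b| iterations always suffice.
  hopMerge : List Node → List Node → List Node × ℕ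
  hopMerge a b = mergeFuel (length a + length b) a b

-- Each iteration of the merge loop consumes a whole segment of at least one input (the hop
-- pointer of its first node jumps to its end) and emits a block of equal keys that is below
-- everything not yet merged.  In a sorted list the segments are exactly the classes of equal
-- keys, so an input with p distinct keys has p segments and the loop runs at most p + q times;
-- sortedness and preservation of the key multiset follow by induction over the iterations.
module Submission where

open import Defs
open import Level using (0ℓ)
open import Algebra.Bundles using (CommutativeMonoid)
import Algebra.Properties.CommutativeSemigroup as CommSemigroupProps
open import Data.Nat using (ℕ; zero; suc; _≤_; _<_; _*_; _+_; s≤s; s≤s⁻¹; z≤n)
import Data.Nat.Properties as ℕ
open import Data.Product using (Σ; _×_; _,_; proj₁; proj₂; map₁)
open import Data.List using (List; []; _∷_; _++_; length; map; filter; splitAt; deduplicate)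
import Data.List.Properties as List
open import Data.List.Relation.Unary.All as All using (All; []; _∷_)
import Data.List.Relation.Unary.All.Properties as All
open import Data.List.Relation.Unary.AllPairs using (AllPairs; []; _∷_)
import Data.List.Relation.Unary.AllPairs.Properties as AllPairs
import Data.List.Relation.Unary.Linked.Properties as Linked
open import Data.List.Relation.Binary.Permutation.Propositional using (_↭_; ↭-refl; ↭-sym; ↭-reflexive; module PermutationReasoning)
import Data.List.Relation.Binary.Permutation.Propositional.Properties as Perm
open import Function using (_∘_; _on_)
open import Relation.Nullary using (¬_; ¬?)
open import Relation.Unary using (_≐_)
open import Relation.Binary using (StrictTotalOrder; DecSetoid; tri<; tri≈; tri>)
import Relation.Binary.Properties.StrictTotalOrder as StrictTotalOrderProps
open import Relation.Binary.PropositionalEquality using (_≡_; refl; sym; cong; module ≡-Reasoning)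

splitAt-length-++ : ∀ {a} {A : Set a} (xs ys : List A) → splitAt (length xs) (xs ++ ys) ≡ (xs , ys)
splitAt-length-++ []       ys = refl
splitAt-length-++ (x ∷ xs) ys = cong (map₁ (x ∷_)) (splitAt-length-++ xs ys)

AllPairs-++⁻ʳ : ∀ {a ℓ} {A : Set a} {R : A → A → Set ℓ} (xs : List A) {ys : List A} →
                AllPairs R (xs ++ ys) → AllPairs R ys
AllPairs-++⁻ʳ []       rs       = rs
AllPairs-++⁻ʳ (x ∷ xs) (_ ∷ rs) = AllPairs-++⁻ʳ xs rs

↭-interchange : ∀ {a} {A : Set a} (ws xs ys zs : List A) →
                (ws ++ xs) ++ (ys ++ zs) ↭ (ws ++ ys) ++ (xs ++ zs)
↭-interchange {A = A} = CommSemigroupProps.interchange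
  (CommutativeMonoid.commutativeSemigroup (Perm.++-commutativeMonoid {A = A}))

module _ {c ℓ} (S : DecSetoid c ℓ) where
  open DecSetoid S using (_≈_; _≟_)
  private module ≈ = DecSetoid S

  filter-≉-deduplicate-++ : ∀ {k} ws xs → All (_≈ k) ws →
    filter (¬? ∘ (k ≟_)) (deduplicate _≟_ (ws ++ xs)) ≡ filter (¬? ∘ (k ≟_)) (deduplicate _≟_ xs)
  filter-≉-deduplicate-++ [] xs [] = refl
  filter-≉-deduplicate-++ {k} (w ∷ ws) xs (w≈k ∷ ws≈k) = begin
    filter k≉? (w ∷ filter (¬? ∘ (w ≟_)) D) ≡⟨ List.filter-reject k≉? (λ k≉w → k≉w (≈.sym w≈k)) ⟩
    filter k≉? (filter (¬? ∘ (w ≟_)) D)     ≡⟨ cong (filter k≉?) (List.filter-≐ (¬? ∘ (w ≟_)) k≉? k≉⇔w≉ D) ⟩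
    filter k≉? (filter k≉? D)               ≡⟨ List.filter-idem k≉? D ⟩
    filter k≉? D                            ≡⟨ filter-≉-deduplicate-++ ws xs ws≈k ⟩
    filter k≉? (deduplicate _≟_ xs)         ∎
    where
    open ≡-Reasoning
    k≉? = ¬? ∘ (k ≟_)
    D = deduplicate _≟_ (ws ++ xs)
    k≉⇔w≉ : (λ y → ¬ w ≈ y) ≐ (λ y → ¬ k ≈ y)
    k≉⇔w≉ = (λ w≉y k≈y → w≉y (≈.trans w≈k k≈y)) , (λ k≉y w≈y → k≉y (≈.trans (≈.sym w≈k) w≈y))

  deduplicate-∷-block : ∀ {k} ws xs → All (_≈ k) ws → All (λ x → ¬ k ≈ x) xs →
                        deduplicate _≟_ (k ∷ ws ++ xs) ≡ k ∷ deduplicate _≟_ xs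
  deduplicate-∷-block {k} ws xs ws≈k xs≉k = cong (k ∷_) (begin
    filter (¬? ∘ (k ≟_)) (deduplicate _≟_ (ws ++ xs)) ≡⟨ filter-≉-deduplicate-++ ws xs ws≈k ⟩
    filter (¬? ∘ (k ≟_)) (deduplicate _≟_ xs)         ≡⟨ List.filter-all (¬? ∘ (k ≟_)) (All.deduplicate⁺ _≟_ xs≉k) ⟩
    deduplicate _≟_ xs                                 ∎)
    where open ≡-Reasoning

module HopMerge (O : StrictTotalOrder 0ℓ 0ℓ 0ℓ) where
  open HopLists O
  open StrictTotalOrder O using (_≈_; _≟_; compare) renaming (Carrier to Key; _<_ to _<ₖ_)
  private
    module ≈ = StrictTotalOrder.Eq O
    module ≤ = StrictTotalOrderProps O
  open ≤ using () renaming (_≤_ to _≤ₖ_)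
  open import Relation.Binary.Construct.StrictToNonStrict _≈_ _<ₖ_ using (<⇒≤)

  Keys : List Node → List Key
  Keys = map key

  -- Sorted in AllPairs form, which is the one that is preserved by concatenation.
  Ordered : List Node → Set
  Ordered = AllPairs (_≤ₖ_ on key)

  sorted⇒ordered : ∀ {L} → Sorted L → Ordered L
  sorted⇒ordered = AllPairs.map⁻ ∘ Linked.Linked⇒AllPairs ≤.trans

  ordered⇒sorted : ∀ {L} → Ordered L → Sorted L
  ordered⇒sorted = Linked.AllPairs⇒Linked ∘ AllPairs.map⁺

  ≈-block-ordered : ∀ {k E} → All (λ e → key e ≈ k) E → Ordered E
  ≈-block-ordered []             = []
  ≈-block-ordered (e≈k ∷ es≈k) =
    All.map (λ e′≈k → ≤.reflexive (≈.trans e≈k (≈.sym e′≈k))) es≈k ∷ ≈-block-ordered es≈k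

  head-≤ : ∀ {x L} → Ordered (x ∷ L) → All (λ y → key x ≤ₖ key y) (x ∷ L)
  head-≤ (x≤L ∷ _) = ≤.refl ∷ x≤L

  segment-rest-≤ : ∀ {x} zs {ra} → Ordered (x ∷ zs ++ ra) → All (λ y → key x ≤ₖ key y) ra
  segment-rest-≤ zs (x≤ ∷ _) = All.++⁻ʳ zs x≤

  segment-rest-ordered : ∀ {x} zs {ra} → Ordered (x ∷ zs ++ ra) → Ordered ra
  segment-rest-ordered zs (_ ∷ ord) = AllPairs-++⁻ʳ zs ord

  notContinuing⇒≉ : ∀ {k} ra → NotContinuing k ra → All (λ y → k ≤ₖ key y) ra → Ordered ra →
                    All (λ y → ¬ k ≈ key y) ra
  notContinuing⇒≉ []      _     _           _            = []
  notContinuing⇒≉ (r ∷ _) r≉k (k≤r ∷ _) (r≤rs ∷ _) =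
    All.map (λ r≤y k≈y → r≉k (≤.antisym (≤.trans r≤y (≤.reflexive (≈.sym k≈y))) k≤r)) (≤.refl ∷ r≤rs)

  distinctKeys-segment : ∀ x zs ra → All (λ z → key z ≈ key x) zs → NotContinuing (key x) ra →
                         Ordered (x ∷ zs ++ ra) → distinctKeys (x ∷ zs ++ ra) ≡ suc (distinctKeys ra)
  distinctKeys-segment x zs ra zs≈x ra≉x ord = cong length (begin
    deduplicate _≟_ (key x ∷ Keys (zs ++ ra))
      ≡⟨ cong (deduplicate _≟_ ∘ (key x ∷_)) (List.map-++ key zs ra) ⟩
    deduplicate _≟_ (key x ∷ Keys zs ++ Keys ra)
      ≡⟨ deduplicate-∷-block ≈.decSetoid (Keys zs) (Keys ra) (All.map⁺ zs≈x) (All.map⁺ keys≉x) ⟩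
    key x ∷ deduplicate _≟_ (Keys ra)
      ∎)
    where
    open ≡-Reasoning
    keys≉x : All (λ r → ¬ key x ≈ key r) ra
    keys≉x = notContinuing⇒≉ ra ra≉x (segment-rest-≤ zs ord) (segment-rest-ordered zs ord)

  length-segment-< : ∀ (x : Node) zs ra → length ra < length (x ∷ zs ++ ra)
  length-segment-< x zs ra = s≤s (List.length-++-≤ʳ ra {zs})

  record Step (a b : List Node) : Set where
    field
      emitted a′ b′  : List Node
      pivot          : Key
      emitted≈pivot  : All (λ e → key e ≈ pivot) emitted
      pivot≤rest     : All (λ y → pivot ≤ₖ key y) (a′ ++ b′)
      keys-↭         : Keys (emitted ++ a′ ++ b′) ↭ Keys (a ++ b)
      a′-ordered     : Ordered a′
      a′-hopInv      : HopInv a′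
      b′-ordered     : Ordered b′
      b′-hopInv      : HopInv b′
      length-<       : length a′ + length b′ < length a + length b
      distinctKeys-< : distinctKeys a′ + distinctKeys b′ < distinctKeys a + distinctKeys b

  step-< : ∀ {x xs y ys} → Ordered (x ∷ xs) → HopInv (x ∷ xs) → Ordered (y ∷ ys) → HopInv (y ∷ ys) →
           key x <ₖ key y → Step (x ∷ xs) (y ∷ ys)
  step-< {y = y} {ys} ordA (seg x zs ra _ zs≈x ra≉x invRa) ordB invB x<y = record
    { emitted        = x ∷ zs
    ; a′             = ra
    ; b′             = y ∷ ys
    ; pivot          = key x
    ; emitted≈pivot  = ≈.refl ∷ zs≈x
    ; pivot≤rest     = All.++⁺ (segment-rest-≤ zs ordA) (All.map (≤.trans (<⇒≤ x<y)) (head-≤ ordB))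
    ; keys-↭         = ↭-reflexive (cong Keys (sym (List.++-assoc (x ∷ zs) ra (y ∷ ys))))
    ; a′-ordered     = segment-rest-ordered zs ordA
    ; a′-hopInv      = invRa
    ; b′-ordered     = ordB
    ; b′-hopInv      = invB
    ; length-<       = ℕ.+-monoˡ-< (length (y ∷ ys)) (length-segment-< x zs ra)
    ; distinctKeys-< = ℕ.+-monoˡ-< (distinctKeys (y ∷ ys))
                         (ℕ.≤-reflexive (sym (distinctKeys-segment x zs ra zs≈x ra≉x ordA)))
    }

  step-> : ∀ {x xs y ys} → Ordered (x ∷ xs) → HopInv (x ∷ xs) → Ordered (y ∷ ys) → HopInv (y ∷ ys) →
           key y <ₖ key x → Step (x ∷ xs) (y ∷ ys)
  step-> {x} {xs} ordA invA ordB (seg y ws rb _ ws≈y rb≉y invRb) y<x = record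
    { emitted        = y ∷ ws
    ; a′             = x ∷ xs
    ; b′             = rb
    ; pivot          = key y
    ; emitted≈pivot  = ≈.refl ∷ ws≈y
    ; pivot≤rest     = All.++⁺ (All.map (≤.trans (<⇒≤ y<x)) (head-≤ ordA)) (segment-rest-≤ ws ordB)
    ; keys-↭         = Perm.map⁺ key (Perm.shifts (y ∷ ws) (x ∷ xs))
    ; a′-ordered     = ordA
    ; a′-hopInv      = invA
    ; b′-ordered     = segment-rest-ordered ws ordB
    ; b′-hopInv      = invRb
    ; length-<       = ℕ.+-monoʳ-< (length (x ∷ xs)) (length-segment-< y ws rb)
    ; distinctKeys-< = ℕ.+-monoʳ-< (distinctKeys (x ∷ xs))
                         (ℕ.≤-reflexive (sym (distinctKeys-segment y ws rb ws≈y rb≉y ordB)))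
    }

  step-≈ : ∀ {x xs y ys} → Ordered (x ∷ xs) → HopInv (x ∷ xs) → Ordered (y ∷ ys) → HopInv (y ∷ ys) →
           key x ≈ key y → Step (x ∷ xs) (y ∷ ys)
  step-≈ ordA (seg x zs ra _ zs≈x ra≉x invRa) ordB (seg y ws rb _ ws≈y rb≉y invRb) x≈y = record
    { emitted        = redirect (length (x ∷ zs)) (hop y) (x ∷ zs) ++ y ∷ ws
    ; a′             = ra
    ; b′             = rb
    ; pivot          = key x
    ; emitted≈pivot  = All.++⁺ (≈.refl ∷ zs≈x) (All.map (λ w≈y → ≈.trans w≈y (≈.sym x≈y)) (≈.refl ∷ ws≈y))
    ; pivot≤rest     = All.++⁺ (segment-rest-≤ zs ordA)
                               (All.map (≤.trans (≤.reflexive x≈y)) (segment-rest-≤ ws ordB))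
    ; keys-↭         = Perm.map⁺ key (↭-interchange (x ∷ zs) (y ∷ ws) ra rb)
    ; a′-ordered     = segment-rest-ordered zs ordA
    ; a′-hopInv      = invRa
    ; b′-ordered     = segment-rest-ordered ws ordB
    ; b′-hopInv      = invRb
    ; length-<       = ℕ.+-mono-< (length-segment-< x zs ra) (length-segment-< y ws rb)
    ; distinctKeys-< = ℕ.+-mono-< (ℕ.≤-reflexive (sym (distinctKeys-segment x zs ra zs≈x ra≉x ordA)))
                                  (ℕ.≤-reflexive (sym (distinctKeys-segment y ws rb ws≈y rb≉y ordB)))
    }

  open Step

  mergeFuel-step : ∀ f {x xs y ys} (ordA : Ordered (x ∷ xs)) (invA : HopInv (x ∷ xs))
                   (ordB : Ordered (y ∷ ys)) (invB : HopInv (y ∷ ys)) →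
    Σ (Step (x ∷ xs) (y ∷ ys)) λ s →
      mergeFuel (suc f) (x ∷ xs) (y ∷ ys)
        ≡ (emitted s ++ proj₁ (mergeFuel f (a′ s) (b′ s)) , suc (proj₂ (mergeFuel f (a′ s) (b′ s))))
  -- Matching the hop equation with refl is what lets `segment` cut exactly after the first segment.
  mergeFuel-step f ordA invA@(seg (node k _) zs ra refl _ _ _) ordB invB@(seg (node k′ _) ws rb refl _ _ _)
    with compare k k′
  ... | tri< k<k′ _ _ rewrite splitAt-length-++ zs ra = step-< ordA invA ordB invB k<k′ , refl
  ... | tri> _ _ k′<k rewrite splitAt-length-++ ws rb = step-> ordA invA ordB invB k′<k , refl
  ... | tri≈ _ k≈k′ _ rewrite splitAt-length-++ zs ra | splitAt-length-++ ws rb =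
    step-≈ ordA invA ordB invB k≈k′ , refl

  record MergeSpec (a b : List Node) (result : List Node × ℕ) : Set where
    field
      ordered     : Ordered (proj₁ result)
      keys-↭      : Keys (proj₁ result) ↭ Keys (a ++ b)
      iterations≤ : proj₂ result ≤ distinctKeys a + distinctKeys b

  step-spec : ∀ {a b out c} (s : Step a b) → MergeSpec (a′ s) (b′ s) (out , c) →
              MergeSpec a b (emitted s ++ out , suc c)
  step-spec {a} {b} {out} s spec = record
    { ordered     = AllPairs.++⁺ (≈-block-ordered (emitted≈pivot s)) (MergeSpec.ordered spec)
                      (All.map (λ e≈p → All.map (≤.trans (≤.reflexive e≈p)) pivot≤out) (emitted≈pivot s))
    ; keys-↭      = begin
        Keys (emitted s ++ out)                 ≡⟨ List.map-++ key (emitted s) out ⟩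
        Keys (emitted s) ++ Keys out            ↭⟨ Perm.++⁺ˡ (Keys (emitted s)) (MergeSpec.keys-↭ spec) ⟩
        Keys (emitted s) ++ Keys (a′ s ++ b′ s) ≡⟨ List.map-++ key (emitted s) (a′ s ++ b′ s) ⟨
        Keys (emitted s ++ a′ s ++ b′ s)        ↭⟨ keys-↭ s ⟩
        Keys (a ++ b)                           ∎
    ; iterations≤ = ℕ.≤-trans (s≤s (MergeSpec.iterations≤ spec)) (distinctKeys-< s)
    }
    where
    open PermutationReasoning
    pivot≤out : All (λ y → pivot s ≤ₖ key y) out
    pivot≤out = All.map⁻ (Perm.All-resp-↭ (↭-sym (MergeSpec.keys-↭ spec)) (All.map⁺ (pivot≤rest s)))

  mergeFuel-spec : ∀ f a b → length a + length b ≤ f → Ordered a → HopInv a → Ordered b → HopInv b →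
                   MergeSpec a b (mergeFuel f a b)
  mergeFuel-spec f [] b _ _ _ ordB _ = record { ordered = ordB ; keys-↭ = ↭-refl ; iterations≤ = z≤n }
  mergeFuel-spec f a@(_ ∷ _) [] _ ordA _ _ _ = record
    { ordered = ordA ; keys-↭ = ↭-reflexive (cong Keys (sym (List.++-identityʳ a))) ; iterations≤ = z≤n }
  mergeFuel-spec zero (_ ∷ _) (_ ∷ _) () _ _ _ _
  mergeFuel-spec (suc f) (_ ∷ _) (_ ∷ _) fuel ordA invA ordB invB
    with mergeFuel-step f ordA invA ordB invB
  ... | s , unfolds rewrite unfolds = step-spec s
          (mergeFuel-spec f (a′ s) (b′ s) (s≤s⁻¹ (ℕ.≤-trans (length-< s) fuel))
            (a′-ordered s) (a′-hopInv s) (b′-ordered s) (b′-hopInv s))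

  hopMerge-spec : ∀ L₁ L₂ → Sorted L₁ → HopInv L₁ → Sorted L₂ → HopInv L₂ → MergeSpec L₁ L₂ (hopMerge L₁ L₂)
  hopMerge-spec L₁ L₂ s₁ h₁ s₂ h₂ =
    mergeFuel-spec (length L₁ + length L₂) L₁ L₂ ℕ.≤-refl (sorted⇒ordered s₁) h₁ (sorted⇒ordered s₂) h₂

lemma1 : Σ ℕ λ c → (O : StrictTotalOrder 0ℓ 0ℓ 0ℓ) → let open HopLists O in
    ∀ L₁ L₂ → Sorted L₁ → HopInv L₁ → Sorted L₂ → HopInv L₂ →
      Sorted (proj₁ (hopMerge L₁ L₂))
      × (map key (proj₁ (hopMerge L₁ L₂)) ↭ map key (L₁ ++ L₂))
      × proj₂ (hopMerge L₁ L₂) ≤ c * (distinctKeys L₁ + distinctKeys L₂)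
lemma1 = 1 , λ O L₁ L₂ s₁ h₁ s₂ h₂ →
  let open HopMerge O
      open MergeSpec (hopMerge-spec L₁ L₂ s₁ h₁ s₂ h₂)
  in ordered⇒sorted ordered , keys-↭ , ℕ.≤-trans iterations≤ (ℕ.≤-reflexive (sym (ℕ.*-identityˡ _)))
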